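{- Let $Z=Z(V_R\cup V_B)$ be a $d$-dimensional symmetric $\Pi$-zonotope with $V_R\cup V_B\subseteq V(d)$ whose graph $G_Z$ (on $d+1$ vertices) is connected, with red subgraph $G_R$ and blue subgraph $G_B$ (spanning subgraphs on all $d+1$ vertices formed by the red, resp. blue, edges). Two vertices lying in the same component of $G_R$ lie in the same component of $G_B$ if and only if their distance in $G_R$ is even; symmetrically, two vertices in the same component of $G_B$ lie in the same component of $G_R$ iff their distance in $G_B$ is even. Consequently $G_Z$ is bipartite.
   Context: Let $\mathbf e_1,\dots,\mathbf e_{d+1}$ be the standard basis of $\mathbb R^{d+1}$, $\mathbf e_{ij}=\mathbf e_i-\mathbf e_j$, $V(d)=\{\mathbf e_{ij}:i<j\}$, $Z(V)=\sum_{\mathbf v\in V}[\mathbf 0,\mathbf v]$. The graph of $Z(V)$ has vertices $1,\dots,d+1$ and an edge $\{i,j\}$ iff $\pm\mathbf e_{ij}\in V$; edges from $V_R$ are red, from $V_B$ blue. Two sets $V_1,V_2$ in a $d$-dimensional space, each of $d-1$ vectors spanning a $(d-1)$-dimensional subspace, are conjugate if for all $\mathbf u_1\in V_1,\mathbf u_2\in V_2$ both $\{\mathbf u_1\}\cup V_2$ and $\{\mathbf u_2\}\cup V_1$ span $d$-dimensional spaces; $Z(V_R\cup V_B)$ is symmetric if $V_R,V_B$ are conjugate in the span of $V_R\cup V_B$. -}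

module Defs where

open import Data.Nat using (ℕ; zero; suc; _≤_)
open import Data.Fin using (Fin; zero; suc; _≟_)
open import Data.Rational using (ℚ; 0ℚ; 1ℚ; -_; _+_; _*_)
open import Data.Product using (_×_; _,_; ∃; proj₁; proj₂)
open import Data.Sum using (_⊎_)
open import Data.Bool using (Bool; if_then_else_)
open import Data.List using (List; []; _∷_; length; map; lookup)
open import Data.List.Membership.Propositional using (_∈_)
open import Data.List.Relation.Binary.Sublist.Propositional using (_⊆_)
open import Relation.Binary.PropositionalEquality using (_≡_)
open import Relation.Nullary using (does; ¬_)

Vector : ℕ → Set
Vector n = Fin n → ℚ

e : ∀ {n} → Fin n → Fin n → Vector n
e i j k = if does (k ≟ i) then 1ℚ else (if does (k ≟ j) then - 1ℚ else 0ℚ)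

vec : ∀ {n} → Fin n × Fin n → Vector n
vec (i , j) = e i j

vecs : ∀ {n} → List (Fin n × Fin n) → List (Vector n)
vecs = map vec

sumFin : (m : ℕ) → (Fin m → ℚ) → ℚ
sumFin zero    f = 0ℚ
sumFin (suc m) f = f zero + sumFin m (λ i → f (suc i))

LinIndep : ∀ {n} → List (Vector n) → Set
LinIndep {n} vs =
  (c : Fin (length vs) → ℚ) →
  (∀ (k : Fin n) → sumFin (length vs) (λ i → c i * lookup vs i k) ≡ 0ℚ) →
  ∀ i → c i ≡ 0ℚ

HasRank : ∀ {n} → List (Vector n) → ℕ → Set
HasRank vs k =
  (∃ λ ws → ws ⊆ vs × length ws ≡ k × LinIndep ws) ×
  (∀ ws → ws ⊆ vs → LinIndep ws → length ws ≤ k)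

-- graph on vertices Fin n determined by a set of pairs: edge {u,v} iff ±e_uv ∈ V
Adj : ∀ {n} → List (Fin n × Fin n) → Fin n → Fin n → Set
Adj V u v = ((u , v) ∈ V) ⊎ ((v , u) ∈ V)

data Walk {n : ℕ} (A : Fin n → Fin n → Set) : Fin n → Fin n → ℕ → Set where
  here : ∀ {u} → Walk A u u 0
  step : ∀ {u v w m} → A u v → Walk A v w m → Walk A u w (suc m)

Conn : ∀ {n} → (Fin n → Fin n → Set) → Fin n → Fin n → Set
Conn A u v = ∃ λ m → Walk A u v m

Dist : ∀ {n} → (Fin n → Fin n → Set) → Fin n → Fin n → ℕ → Set
Dist A u v m = Walk A u v m × (∀ m' → Walk A u v m' → m ≤ m')

Bipartite : ∀ {n} → (Fin n → Fin n → Set) → Set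
Bipartite {n} A = ∃ λ (c : Fin n → Bool) → ∀ u v → A u v → ¬ (c u ≡ c v)

module Submission where

-- Write 𝟙_u for the u-th standard basis vector and e_uv = 𝟙_u - 𝟙_v.
-- (1) Linear algebra: along a walk from u to v in the graph of an edge list E,
--     𝟙_u - 𝟙_v telescopes into a ℚ-combination of the edge vectors of E.  So an
--     edge e_uv independent of the vectors of E joins two different components
--     of the graph of E (lemma `bridge`).
-- (2) Forests: if the edge vectors of a loopless E are independent, the graph of E
--     on n vertices has a component labelling with at most n - |E| labels, built
--     edge by edge, each edge merging two components (`forestLabelling`).  With
--     d - 1 blue edges on d + 1 vertices there are at most two blue components,
--     so a Boolean `side` decides whether two vertices are blue-connected.
-- (3) By (1) and conjugacy every red edge joins the two blue sides: `side`
--     properly 2-colours the red graph.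
-- (4) Parity: in a properly 2-coloured graph the colour flips at every step of a
--     walk, so the ends of a walk have equal colours iff it has even length.
--     Applied to a shortest red walk this is the first claim; the second is
--     symmetric; and the xor of the two sides properly colours G_R ∪ G_B.

open import Defs
open import Data.Nat using (ℕ; zero; suc; _∸_; _≤_; z≤n; s≤s)
open import Data.Nat.Properties using (+-identityʳ; +-suc; +-cancelʳ-≤; m≤n+m∸n; ≤⇒≯; module ≤-Reasoning)
open import Data.Nat.Divisibility using (_∣_; divides; ∣1⇒≡1; ∣m∣n⇒∣m+n; ∣m+n∣m⇒∣n; ∣-refl)
open import Data.Fin using (Fin; zero; suc; _≟_; _<_)
open import Data.Fin.Properties using (<⇒≢; any?)
import Data.Product.Properties as Product
open import Data.Product using (_×_; _,_; ∃; proj₁; proj₂)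
open import Data.Sum using (_⊎_; inj₁; inj₂)
open import Data.Bool using (Bool; true; false; not; _xor_)
open import Data.Bool.Properties
  using (¬-not; not-¬; not-injective; not-involutive; not-distribˡ-xor; not-distribʳ-xor; xor-comm)
open import Data.Empty using (⊥-elim)
open import Data.List using (List; []; _∷_; _++_; length; allFin)
open import Data.List.Properties using (length-map; length-tabulate; length-removeAt′)
open import Data.List.Membership.Propositional using (_∈_)
open import Data.List.Membership.Propositional.Properties using (∈-allFin; ∈-++⁻)
import Data.List.Membership.DecPropositional as DecMembership
open import Data.List.Relation.Unary.Any using (here; there; index; _─_)
open import Data.List.Relation.Unary.All as All using (All)
open import Data.List.Relation.Unary.Unique.Propositional using (Unique)
open import Data.List.Relation.Binary.Sublist.Heterogeneous.Properties using (toPointwise)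
open import Data.List.Relation.Binary.Pointwise using (Pointwise-≡⇒≡)
open import Function using (id; _∘_; case_of_)
open import Function.Bundles using (_⇔_; mk⇔; Equivalence)
open import Function.Construct.Composition using (_⇔-∘_)
open import Relation.Binary.PropositionalEquality
open import Relation.Nullary using (¬_; Dec; yes; no; does)
open import Relation.Nullary.Decidable using (_×-dec_; _⊎-dec_)

-- Linear algebra over ℚ: spans of edge vectors and the bridge lemma.
module EdgeVectors where
  open import Data.Rational using (ℚ; 0ℚ; 1ℚ; -_; _+_; _*_; _-_)
  import Data.Rational.Properties as ℚ
  open import Data.Rational.Solver using (module +-*-Solver)
  open import Data.Bool using (if_then_else_)
  open import Data.List using (lookup)
  open import Data.List.Membership.Propositional.Properties using (∈-map⁺)
  open import Data.List.Relation.Unary.Any.Properties using (lookup-index)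
  open +-*-Solver using (solve; _:+_; _:-_; :-_; _:=_)

  sumFin-cong : ∀ m {f g : Fin m → ℚ} → (∀ i → f i ≡ g i) → sumFin m f ≡ sumFin m g
  sumFin-cong zero    f≗g = refl
  sumFin-cong (suc m) f≗g = cong₂ _+_ (f≗g zero) (sumFin-cong m (λ i → f≗g (suc i)))

  sumFin-zero : ∀ m → sumFin m (λ _ → 0ℚ) ≡ 0ℚ
  sumFin-zero zero    = refl
  sumFin-zero (suc m) = trans (ℚ.+-identityˡ _) (sumFin-zero m)

  sumFin-+ : ∀ m (f g : Fin m → ℚ) →
             sumFin m (λ i → f i + g i) ≡ sumFin m f + sumFin m g
  sumFin-+ zero    f g = refl
  sumFin-+ (suc m) f g
    rewrite sumFin-+ m (λ i → f (suc i)) (λ i → g (suc i)) =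
    solve 4 (λ a b c d → (a :+ b) :+ (c :+ d) := (a :+ c) :+ (b :+ d)) refl
      (f zero) (g zero) (sumFin m (λ i → f (suc i))) (sumFin m (λ i → g (suc i)))

  sumFin-neg : ∀ m (f : Fin m → ℚ) → sumFin m (λ i → - f i) ≡ - sumFin m f
  sumFin-neg zero    f = refl
  sumFin-neg (suc m) f rewrite sumFin-neg m (λ i → f (suc i)) =
    sym (ℚ.neg-distrib-+ (f zero) (sumFin m (λ i → f (suc i))))

  select : ∀ {m} → Fin m → Fin m → ℚ
  select zero    zero    = 1ℚ
  select zero    (suc _) = 0ℚ
  select (suc _) zero    = 0ℚ
  select (suc j) (suc i) = select j i

  sumFin-select : ∀ m (j : Fin m) (x : Fin m → ℚ) → sumFin m (λ i → select j i * x i) ≡ x j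
  sumFin-select (suc m) zero x = begin
    1ℚ * x zero + sumFin m (λ i → 0ℚ * x (suc i))
      ≡⟨ cong₂ _+_ (ℚ.*-identityˡ (x zero)) (sumFin-cong m (λ i → ℚ.*-zeroˡ (x (suc i)))) ⟩
    x zero + sumFin m (λ _ → 0ℚ)
      ≡⟨ cong (x zero +_) (sumFin-zero m) ⟩
    x zero + 0ℚ
      ≡⟨ ℚ.+-identityʳ (x zero) ⟩
    x zero ∎
    where open ≡-Reasoning
  sumFin-select (suc m) (suc j) x =
    trans (cong₂ _+_ (ℚ.*-zeroˡ (x zero)) (sumFin-select m j (λ i → x (suc i))))
          (ℚ.+-identityˡ _)

  InSpan : ∀ {n} → List (Vector n) → Vector n → Set
  InSpan {n} vs x = ∃ λ (c : Fin (length vs) → ℚ) →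
    ∀ k → sumFin (length vs) (λ i → c i * lookup vs i k) ≡ x k

  module _ {n : ℕ} (vs : List (Vector n)) where
    span-resp : ∀ {x y} → (∀ k → x k ≡ y k) → InSpan vs x → InSpan vs y
    span-resp x≗y (c , sum≗x) = c , λ k → trans (sum≗x k) (x≗y k)

    span-zero : InSpan vs (λ _ → 0ℚ)
    span-zero = (λ _ → 0ℚ) , λ k →
      trans (sumFin-cong (length vs) (λ i → ℚ.*-zeroˡ (lookup vs i k))) (sumFin-zero (length vs))

    span-+ : ∀ {x y} → InSpan vs x → InSpan vs y → InSpan vs (λ k → x k + y k)
    span-+ (c , hx) (c′ , hy) = (λ i → c i + c′ i) , λ k →
      trans (sumFin-cong (length vs) (λ i → ℚ.*-distribʳ-+ _ (c i) (c′ i)))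
        (trans (sumFin-+ (length vs) _ _) (cong₂ _+_ (hx k) (hy k)))

    span-neg : ∀ {x} → InSpan vs x → InSpan vs (λ k → - x k)
    span-neg (c , hx) = (λ i → - c i) , λ k →
      trans (sumFin-cong (length vs) (λ i → sym (ℚ.neg-distribˡ-* (c i) _)))
        (trans (sumFin-neg (length vs) _) (cong -_ (hx k)))

    span-member : (j : Fin (length vs)) → InSpan vs (lookup vs j)
    span-member j = select j , λ k → sumFin-select (length vs) j (λ i → lookup vs i k)

  indep-tail : ∀ {n} {x : Vector n} {vs} → LinIndep (x ∷ vs) → LinIndep vs
  indep-tail {x = x} {vs} indep c sum≡0 i = indep c′ sum′≡0 (suc i)
    where
    c′ : Fin (suc (length vs)) → ℚ
    c′ zero    = 0ℚ
    c′ (suc i) = c i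
    sum′≡0 : ∀ k → 0ℚ * x k + sumFin (length vs) (λ i → c i * lookup vs i k) ≡ 0ℚ
    sum′≡0 k = trans (cong₂ _+_ (ℚ.*-zeroˡ (x k)) (sum≡0 k)) (ℚ.+-identityʳ 0ℚ)

  indep⇒∉span : ∀ {n} {x : Vector n} {vs} → LinIndep (x ∷ vs) → ¬ InSpan vs x
  indep⇒∉span {x = x} {vs} indep (c , hx) = ℚ.1≢0 (indep c′ sum′≡0 zero)
    where
    c′ : Fin (suc (length vs)) → ℚ
    c′ zero    = 1ℚ
    c′ (suc i) = - c i
    sum′≡0 : ∀ k → 1ℚ * x k + sumFin (length vs) (λ i → - c i * lookup vs i k) ≡ 0ℚ
    sum′≡0 k = begin
      1ℚ * x k + sumFin (length vs) (λ i → - c i * lookup vs i k)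
        ≡⟨ cong₂ _+_ (ℚ.*-identityˡ (x k))
             (sumFin-cong (length vs) (λ i → sym (ℚ.neg-distribˡ-* (c i) _))) ⟩
      x k + sumFin (length vs) (λ i → - (c i * lookup vs i k))
        ≡⟨ cong (x k +_) (trans (sumFin-neg (length vs) _) (cong -_ (hx k))) ⟩
      x k - x k
        ≡⟨ ℚ.+-inverseʳ (x k) ⟩
      0ℚ ∎
      where open ≡-Reasoning

  𝟙 : ∀ {n} → Fin n → Vector n
  𝟙 u k = if does (k ≟ u) then 1ℚ else 0ℚ

  diff : ∀ {n} → Fin n → Fin n → Vector n
  diff u v k = 𝟙 u k - 𝟙 v k

  vec≗diff : ∀ {n} {u v : Fin n} → u ≢ v → ∀ k → vec (u , v) k ≡ diff u v k
  vec≗diff {u = u} {v} u≢v k with k ≟ u | k ≟ v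
  ... | yes refl | yes refl = ⊥-elim (u≢v refl)
  ... | yes _    | no _     = refl
  ... | no _     | yes _    = refl
  ... | no _     | no _     = refl

  diff-trans : ∀ {n} (u w v : Fin n) k → diff u w k + diff w v k ≡ diff u v k
  diff-trans u w v k =
    solve 3 (λ a b c → (a :- b) :+ (b :- c) := a :- c) refl (𝟙 u k) (𝟙 w k) (𝟙 v k)

  diff-swap : ∀ {n} (u w : Fin n) k → - diff w u k ≡ diff u w k
  diff-swap u w k = solve 2 (λ a b → :- (b :- a) := a :- b) refl (𝟙 u k) (𝟙 w k)

  diff-self : ∀ {n} (u : Fin n) k → 0ℚ ≡ diff u u k
  diff-self u k = sym (ℚ.+-inverseʳ (𝟙 u k))

  module _ {n : ℕ} (E : List (Fin n × Fin n)) where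
    edge-span : ∀ {u w} → (u , w) ∈ E → InSpan (vecs E) (diff u w)
    edge-span {u} {w} uw∈E with u ≟ w
    ... | yes refl = span-resp (vecs E) (diff-self u) (span-zero (vecs E))
    ... | no u≢w   = span-resp (vecs E) vec-uw≗diff (span-member (vecs E) (index vec∈vecs))
      where
      vec∈vecs : vec (u , w) ∈ vecs E
      vec∈vecs = ∈-map⁺ vec uw∈E
      vec-uw≗diff : ∀ k → lookup (vecs E) (index vec∈vecs) k ≡ diff u w k
      vec-uw≗diff k = trans (cong (λ x → x k) (sym (lookup-index vec∈vecs))) (vec≗diff u≢w k)

    adj-span : ∀ {u w} → Adj E u w → InSpan (vecs E) (diff u w)
    adj-span (inj₁ uw∈E) = edge-span uw∈E
    adj-span {u} {w} (inj₂ wu∈E) =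
      span-resp (vecs E) (diff-swap u w) (span-neg (vecs E) (edge-span wu∈E))

    walk-span : ∀ {u v m} → Walk (Adj E) u v m → InSpan (vecs E) (diff u v)
    walk-span {u} here = span-resp (vecs E) (diff-self u) (span-zero (vecs E))
    walk-span (step {u} {w} {v} uw rest) =
      span-resp (vecs E) (diff-trans u w v) (span-+ (vecs E) (adj-span uw) (walk-span rest))

    bridge : ∀ {u v} → u ≢ v → LinIndep (vec (u , v) ∷ vecs E) → ¬ Conn (Adj E) u v
    bridge u≢v indep (_ , walk) =
      indep⇒∉span {vs = vecs E} indep (span-resp (vecs E) (λ k → sym (vec≗diff u≢v k)) (walk-span walk))

open EdgeVectors using (indep-tail; bridge)
open import Data.Nat using (_+_)

adj-sym : ∀ {n} {E : List (Fin n × Fin n)} {u v} → Adj E u v → Adj E v u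
adj-sym (inj₁ uv∈E) = inj₂ uv∈E
adj-sym (inj₂ vu∈E) = inj₁ vu∈E

module _ {n : ℕ} {A : Fin n → Fin n → Set} where
  conn-edge : ∀ {u v} → A u v → Conn A u v
  conn-edge a = 1 , step a here

  conn-trans : ∀ {u v w} → Conn A u v → Conn A v w → Conn A u w
  conn-trans (_ , here)        vw = vw
  conn-trans (_ , step a walk) vw with conn-trans (_ , walk) vw
  ... | m , walk′ = suc m , step a walk′

  conn-sym : (∀ {u v} → A u v → A v u) → ∀ {u v} → Conn A u v → Conn A v u
  conn-sym sym-A (_ , here)        = 0 , here
  conn-sym sym-A (_ , step a walk) = conn-trans (conn-sym sym-A (_ , walk)) (conn-edge (sym-A a))

  conn-mono : ∀ {A′ : Fin n → Fin n → Set} → (∀ {u v} → A u v → A′ u v) →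
              ∀ {u v} → Conn A u v → Conn A′ u v
  conn-mono A⊆A′ (_ , here)        = 0 , here
  conn-mono A⊆A′ (_ , step a walk) with conn-mono A⊆A′ (_ , walk)
  ... | m , walk′ = suc m , step (A⊆A′ a) walk′

∈-─ : ∀ {A : Set} {x y : A} {xs : List A} → y ∈ xs → y ≢ x → (x∈xs : x ∈ xs) → y ∈ (xs ─ x∈xs)
∈-─ (here refl) y≢x (here refl) = ⊥-elim (y≢x refl)
∈-─ (there y∈)  y≢x (here refl) = y∈
∈-─ (here refl) y≢x (there x∈)  = here refl
∈-─ (there y∈)  y≢x (there x∈)  = there (∈-─ y∈ y≢x x∈)

record Labelling {n : ℕ} (E : List (Fin n × Fin n)) : Set where
  field
    label      : Fin n → Fin n
    reps       : List (Fin n)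
    label∈reps : ∀ w → label w ∈ reps
    count      : length reps + length E ≡ n
    sound      : ∀ u v → label u ≡ label v → Conn (Adj E) u v
    respects   : ∀ u v → Adj E u v → label u ≡ label v

  complete : ∀ {u v} → Conn (Adj E) u v → label u ≡ label v
  complete (_ , here)            = refl
  complete (_ , step uw walk)    = trans (respects _ _ uw) (complete (_ , walk))

discrete : ∀ {n} → Labelling {n} []
discrete {n} = record
  { label      = id
  ; reps       = allFin n
  ; label∈reps = ∈-allFin
  ; count      = trans (+-identityʳ _) (length-tabulate id)
  ; sound      = λ { u .u refl → 0 , here }
  ; respects   = λ { u v (inj₁ ()) ; u v (inj₂ ()) }
  }

addBridge : ∀ {n} {E : List (Fin n × Fin n)} (L : Labelling E) {a b : Fin n} →
            Labelling.label L a ≢ Labelling.label L b → Labelling ((a , b) ∷ E)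
addBridge {n} {E} L {a} {b} la≢lb = record
  { label      = λ w → merge (label w)
  ; reps       = reps ─ label∈reps b
  ; label∈reps = λ w → ∈-─ (merge∈reps (label∈reps w)) (merge≢lb (label w)) (label∈reps b)
  ; count      = trans (+-suc _ _) (trans (cong (_+ length E) (sym (length-removeAt′ reps _))) count)
  ; sound      = λ u v eq → sound′ u v eq (label u ≟ label b) (label v ≟ label b)
  ; respects   = respects′
  }
  where
  open Labelling L
  E′ : List (Fin n × Fin n)
  E′ = (a , b) ∷ E

  merge : Fin n → Fin n
  merge x with x ≟ label b
  ... | yes _ = label a
  ... | no _  = x

  merge-merged : ∀ {x} → x ≡ label b → merge x ≡ label a
  merge-merged {x} x≡lb with x ≟ label b
  ... | yes _    = refl
  ... | no x≢lb  = ⊥-elim (x≢lb x≡lb)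

  merge-kept : ∀ {x} → x ≢ label b → merge x ≡ x
  merge-kept {x} x≢lb with x ≟ label b
  ... | yes x≡lb = ⊥-elim (x≢lb x≡lb)
  ... | no _     = refl

  merge∈reps : ∀ {x} → x ∈ reps → merge x ∈ reps
  merge∈reps {x} x∈reps with x ≟ label b
  ... | yes _ = label∈reps a
  ... | no _  = x∈reps

  merge≢lb : ∀ x → merge x ≢ label b
  merge≢lb x with x ≟ label b
  ... | yes _    = la≢lb
  ... | no x≢lb  = x≢lb

  old : ∀ {u v} → Conn (Adj E) u v → Conn (Adj E′) u v
  old = conn-mono λ { (inj₁ m) → inj₁ (there m) ; (inj₂ m) → inj₂ (there m) }

  across : ∀ u v → label u ≡ label b → label a ≡ label v → Conn (Adj E′) u v
  across u v lu≡lb la≡lv =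
    conn-trans (old (sound u b lu≡lb)) (conn-trans (conn-edge (inj₂ (here refl))) (old (sound a v la≡lv)))

  sound′ : ∀ u v → merge (label u) ≡ merge (label v) →
           Dec (label u ≡ label b) → Dec (label v ≡ label b) → Conn (Adj E′) u v
  sound′ u v eq (yes u∈b) (yes v∈b) = old (sound u v (trans u∈b (sym v∈b)))
  sound′ u v eq (yes u∈b) (no v∉b)  =
    across u v u∈b (trans (sym (merge-merged u∈b)) (trans eq (merge-kept v∉b)))
  sound′ u v eq (no u∉b)  (yes v∈b) = conn-sym adj-sym
    (across v u v∈b (trans (sym (merge-merged v∈b)) (trans (sym eq) (merge-kept u∉b))))
  sound′ u v eq (no u∉b)  (no v∉b)  =
    old (sound u v (trans (sym (merge-kept u∉b)) (trans eq (merge-kept v∉b))))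

  merge-ends : merge (label a) ≡ merge (label b)
  merge-ends = trans (merge-kept la≢lb) (sym (merge-merged refl))

  respects′ : ∀ u v → Adj E′ u v → merge (label u) ≡ merge (label v)
  respects′ u v (inj₁ (here refl)) = merge-ends
  respects′ u v (inj₂ (here refl)) = sym merge-ends
  respects′ u v (inj₁ (there m))   = cong merge (respects u v (inj₁ m))
  respects′ u v (inj₂ (there m))   = cong merge (respects u v (inj₂ m))

Loopless : ∀ {n} → List (Fin n × Fin n) → Set
Loopless = All (λ p → proj₁ p ≢ proj₂ p)

-- A loopless forest (independent edge vectors) on n vertices has a component
-- labelling with n - |E| labels: by the bridge lemma each new edge joins two
-- different components.
forestLabelling : ∀ {n} (E : List (Fin n × Fin n)) → Loopless E → LinIndep (vecs E) → Labelling E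
forestLabelling []            _               _     = discrete
forestLabelling ((a , b) ∷ E) (a≢b All.∷ nl) indep
  with L ← forestLabelling E nl (indep-tail {vs = vecs E} indep)
  with Labelling.label L a ≟ Labelling.label L b
... | yes la≡lb = ⊥-elim (bridge E a≢b indep (Labelling.sound L a b la≡lb))
... | no la≢lb  = addBridge L la≢lb

distinct3 : ∀ {A : Set} {x y z : A} {xs : List A} → x ∈ xs → y ∈ xs → z ∈ xs →
            x ≢ y → x ≢ z → y ≢ z → 3 ≤ length xs
distinct3 {A} {x} {y} {z} {xs} x∈ y∈ z∈ x≢y x≢z y≢z = begin
  3                                       ≤⟨ s≤s (s≤s (nonempty z∈″)) ⟩
  suc (suc (length ((xs ─ x∈) ─ y∈′)))    ≡⟨ cong suc (sym (length-removeAt′ (xs ─ x∈) _)) ⟩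
  suc (length (xs ─ x∈))                  ≡⟨ sym (length-removeAt′ xs _) ⟩
  length xs                               ∎
  where
  open ≤-Reasoning
  y∈′ : y ∈ (xs ─ x∈)
  y∈′ = ∈-─ y∈ (x≢y ∘ sym) x∈
  z∈″ : z ∈ ((xs ─ x∈) ─ y∈′)
  z∈″ = ∈-─ (∈-─ z∈ (x≢z ∘ sym) x∈) (y≢z ∘ sym) y∈′
  nonempty : ∀ {w : A} {ws} → w ∈ ws → 1 ≤ length ws
  nonempty (here _)  = s≤s z≤n
  nonempty (there _) = s≤s z≤n

SplitsInTwo : ∀ {n} → (Fin n → Fin n → Set) → Set
SplitsInTwo {n} A = ∃ λ (side : Fin n → Bool) → ∀ u v → Conn A u v ⇔ side u ≡ side v

twoLabels⇒split : ∀ {n} {E : List (Fin (suc n) × Fin (suc n))} (L : Labelling E) →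
                  length (Labelling.reps L) ≤ 2 → SplitsInTwo (Adj E)
twoLabels⇒split {n} {E} L few = side , λ u v → mk⇔ (cong side₀ ∘ complete) (sound u v ∘ sameSide u v)
  where
  open Labelling L
  side₀ : Fin (suc n) → Bool
  side₀ l = does (l ≟ label zero)

  side : Fin (suc n) → Bool
  side w = side₀ (label w)

  sameSide : ∀ u v → side u ≡ side v → label u ≡ label v
  sameSide u v eq with label u ≟ label zero | label v ≟ label zero
  ... | yes u₀ | yes v₀ = trans u₀ (sym v₀)
  sameSide u v ()  | yes _ | no _
  sameSide u v ()  | no _  | yes _
  ... | no u≢₀ | no v≢₀ with label u ≟ label v
  ...   | yes lu≡lv = lu≡lv
  ...   | no lu≢lv  = ⊥-elim (≤⇒≯ few (distinct3 (label∈reps u) (label∈reps v) (label∈reps zero) lu≢lv u≢₀ v≢₀))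

forest⇒split : ∀ {n} (E : List (Fin (suc n) × Fin (suc n))) → Loopless E → LinIndep (vecs E) →
               suc n ≤ 2 + length E → SplitsInTwo (Adj E)
forest⇒split E loopless indep many = twoLabels⇒split L
  (+-cancelʳ-≤ (length E) _ 2 (subst (_≤ 2 + length E) (sym (Labelling.count L)) many))
  where
  L : Labelling E
  L = forestLabelling E loopless indep

odd : ℕ → Bool
odd zero    = false
odd (suc m) = not (odd m)

even⇔2∣ : ∀ m → odd m ≡ false ⇔ 2 ∣ m
even⇔2∣ zero          = mk⇔ (λ _ → divides 0 refl) (λ _ → refl)
even⇔2∣ (suc zero)    = mk⇔ (λ ()) (λ 2∣1 → case (∣1⇒≡1 2∣1) of λ ())
even⇔2∣ (suc (suc m)) = mk⇔
  (λ even → ∣m∣n⇒∣m+n (∣-refl {2}) (Equivalence.to (even⇔2∣ m) (trans (sym (not-involutive _)) even)))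
  (λ 2∣2+m → trans (not-involutive _) (Equivalence.from (even⇔2∣ m) (∣m+n∣m⇒∣n 2∣2+m ∣-refl)))

Proper : ∀ {n} → (Fin n → Fin n → Set) → (Fin n → Bool) → Set
Proper A c = ∀ {u v} → A u v → c u ≢ c v

module _ {n : ℕ} {A : Fin n → Fin n → Set} {c : Fin n → Bool} (proper : Proper A c) where
  walk-colour : ∀ {u v m} → Walk A u v m → c v ≡ odd m xor c u
  walk-colour here = refl
  walk-colour {u} (step {v = w} {m = m} uw rest) = begin
    c _                      ≡⟨ walk-colour rest ⟩
    odd m xor c w            ≡⟨ cong (odd m xor_) (¬-not (proper uw ∘ sym)) ⟩
    odd m xor not (c u)      ≡⟨ sym (not-distribʳ-xor (odd m) (c u)) ⟩
    not (odd m xor c u)      ≡⟨ not-distribˡ-xor (odd m) (c u) ⟩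
    not (odd m) xor c u      ∎
    where open ≡-Reasoning

  sameColour⇔even : ∀ {u v m} → Walk A u v m → (c u ≡ c v ⇔ 2 ∣ m)
  sameColour⇔even {u} {v} {m} walk = even⇔2∣ m ⇔-∘ mk⇔ to from
    where
    to : c u ≡ c v → odd m ≡ false
    to cu≡cv with odd m | walk-colour walk
    ... | false | _     = refl
    ... | true  | cv≡¬u = ⊥-elim (not-¬ refl (trans cu≡cv cv≡¬u))
    from : odd m ≡ false → c u ≡ c v
    from even = sym (trans (walk-colour walk) (cong (_xor c u) even))

least : (P : ℕ → Set) → (∀ m → Dec (P m)) → ∀ {m} → P m → ∃ λ k → P k × (∀ k′ → P k′ → k ≤ k′)
least P P? {m} Pm with P? 0
... | yes P0 = 0 , P0 , λ _ _ → z≤n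
least P P? {zero}  Pm | no ¬P0 = ⊥-elim (¬P0 Pm)
least P P? {suc m} Pm | no ¬P0 with least (P ∘ suc) (P? ∘ suc) Pm
... | k , Pk , min = suc k , Pk , minimal
  where
  minimal : ∀ k′ → P k′ → suc k ≤ k′
  minimal zero     P0  = ⊥-elim (¬P0 P0)
  minimal (suc k′) Pk′ = s≤s (min k′ Pk′)

walk? : ∀ {n} {A : Fin n → Fin n → Set} → (∀ u v → Dec (A u v)) → ∀ u v m → Dec (Walk A u v m)
walk? A? u v zero with u ≟ v
... | yes refl = yes here
... | no u≢v   = no λ { here → u≢v refl }
walk? A? u v (suc m) with any? (λ w → A? u w ×-dec walk? A? w v m)
... | yes (w , uw , rest) = yes (step uw rest)
... | no none              = no λ { (step uw rest) → none (_ , uw , rest) }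

distance : ∀ {n} {A : Fin n → Fin n → Set} → (∀ u v → Dec (A u v)) →
           ∀ {u v} → Conn A u v → ∃ λ m → Dist A u v m
distance {A = A} A? {u} {v} (_ , walk) = least (Walk A u v) (walk? A? u v) walk

sameColour⇔evenDistance : ∀ {n} {A : Fin n → Fin n → Set} {c : Fin n → Bool} →
  Proper A c → (∀ u v → Dec (A u v)) →
  ∀ {u v} → Conn A u v → (c u ≡ c v ⇔ ∃ λ m → Dist A u v m × 2 ∣ m)
sameColour⇔evenDistance proper A? conn = mk⇔
  (λ same → let m , walk , min = distance A? conn
            in m , (walk , min) , Equivalence.to (sameColour⇔even proper walk) same)
  (λ { (m , (walk , _) , 2∣m) → Equivalence.from (sameColour⇔even proper walk) 2∣m })

adj? : ∀ {n} (E : List (Fin n × Fin n)) → ∀ u v → Dec (Adj E u v)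
adj? E u v = ((u , v) ∈? E) ⊎-dec ((v , u) ∈? E)
  where open DecMembership (Product.≡-dec _≟_ _≟_) using (_∈?_)

adj-++ : ∀ {n} {X Y : List (Fin n × Fin n)} {u v} → Adj (X ++ Y) u v → Adj X u v ⊎ Adj Y u v
adj-++ {X = X} (inj₁ uv∈) with ∈-++⁻ X uv∈
... | inj₁ uv∈X = inj₁ (inj₁ uv∈X)
... | inj₂ uv∈Y = inj₂ (inj₁ uv∈Y)
adj-++ {X = X} (inj₂ vu∈) with ∈-++⁻ X vu∈
... | inj₁ vu∈X = inj₁ (inj₂ vu∈X)
... | inj₂ vu∈Y = inj₂ (inj₂ vu∈Y)

Crosses : ∀ {n} → (X Y : List (Fin n × Fin n)) → Set
Crosses X Y = ∀ {u v} → Adj X u v → ¬ Conn (Adj Y) u v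

independent⇒crosses : ∀ {n} (X Y : List (Fin n × Fin n)) → Loopless X →
                      (∀ p → p ∈ X → LinIndep (vec p ∷ vecs Y)) → Crosses X Y
independent⇒crosses X Y loopless indep (inj₁ uv∈X) =
  bridge Y (All.lookup loopless uv∈X) (indep _ uv∈X)
independent⇒crosses X Y loopless indep (inj₂ vu∈X) =
  bridge Y (All.lookup loopless vu∈X) (indep _ vu∈X) ∘ conn-sym adj-sym

evenCriterion : ∀ {n} {X Y : List (Fin n × Fin n)} → SplitsInTwo (Adj Y) → Crosses X Y →
  ∀ u v → Conn (Adj X) u v → (Conn (Adj Y) u v ⇔ ∃ λ m → Dist (Adj X) u v m × 2 ∣ m)
evenCriterion {X = X} (side , split) crosses u v conn =
  sameColour⇔evenDistance proper (adj? X) conn ⇔-∘ split u v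
  where
  proper : Proper (Adj X) side
  proper uv same = crosses uv (Equivalence.from (split _ _) same)

xor-cancelˡ : ∀ a {b b′} → a xor b ≡ a xor b′ → b ≡ b′
xor-cancelˡ false eq = eq
xor-cancelˡ true  eq = not-injective eq

xor-cancelʳ : ∀ {a a′} b → a xor b ≡ a′ xor b → a ≡ a′
xor-cancelʳ {a} {a′} b eq = xor-cancelˡ b (trans (xor-comm b a) (trans eq (xor-comm a′ b)))

crossing⇒bipartite : ∀ {n} {R B : List (Fin n × Fin n)} → SplitsInTwo (Adj R) → SplitsInTwo (Adj B) →
                     Crosses R B → Crosses B R → Bipartite (Adj (R ++ B))
crossing⇒bipartite {n} (sideR , splitR) (sideB , splitB) crossesR crossesB = colour , proper
  where
  colour : Fin n → Bool
  colour w = sideR w xor sideB w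

  proper : ∀ u v → Adj _ u v → colour u ≢ colour v
  proper u v uv same with adj-++ uv
  ... | inj₁ red  = crossesR red (Equivalence.from (splitB u v)
        (xor-cancelˡ (sideR u) (trans same (cong (_xor sideB v) (sym sameR)))))
    where
    sameR : sideR u ≡ sideR v
    sameR = Equivalence.to (splitR u v) (conn-edge red)
  ... | inj₂ blue = crossesB blue (Equivalence.from (splitR u v)
        (xor-cancelʳ (sideB u) (trans same (cong (sideR v xor_) (sym sameB)))))
    where
    sameB : sideB u ≡ sideB v
    sameB = Equivalence.to (splitB u v) (conn-edge blue)

hasRank⇒indep : ∀ {n} {vs : List (Vector n)} {k} → HasRank vs k → length vs ≡ k → LinIndep vs
hasRank⇒indep ((ws , ws⊆vs , |ws| , indep) , _) |vs| =
  subst LinIndep (Pointwise-≡⇒≡ (toPointwise (trans |ws| (sym |vs|)) ws⊆vs)) indep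

conjugate⇒indep : ∀ d {n} (X Y : List (Fin n × Fin n)) → length X ≡ d ∸ 1 → length Y ≡ d ∸ 1 →
  (∀ p → p ∈ X → HasRank (vec p ∷ vecs Y) d) → ∀ p → p ∈ X → LinIndep (vec p ∷ vecs Y)
conjugate⇒indep zero    []      Y _ _ _ p ()
conjugate⇒indep (suc d) X       Y _ |Y| rank p p∈X =
  hasRank⇒indep (rank p p∈X) (cong suc (trans (length-map vec Y) |Y|))

mainTheorem13 : (d : ℕ) (R B : List (Fin (suc d) × Fin (suc d))) →
    All (λ p → proj₁ p < proj₂ p) R → All (λ p → proj₁ p < proj₂ p) B →
    Unique R → Unique B →
    length R ≡ d ∸ 1 → length B ≡ d ∸ 1 →
    HasRank (vecs R) (d ∸ 1) → HasRank (vecs B) (d ∸ 1) →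
    HasRank (vecs (R ++ B)) d →
    (∀ p → p ∈ R → HasRank (vec p ∷ vecs B) d) →
    (∀ p → p ∈ B → HasRank (vec p ∷ vecs R) d) →
    (∀ u v → Conn (Adj (R ++ B)) u v) →
    (∀ u v → Conn (Adj R) u v →
    (Conn (Adj B) u v ⇔ ∃ λ m → Dist (Adj R) u v m × 2 ∣ m)) ×
    (∀ u v → Conn (Adj B) u v →
    (Conn (Adj R) u v ⇔ ∃ λ m → Dist (Adj B) u v m × 2 ∣ m)) ×
    Bipartite (Adj (R ++ B))
mainTheorem13 d R B <R <B _ _ |R| |B| rankR rankB _ conjR conjB _ =
  evenCriterion splitB crossesR , evenCriterion splitR crossesB ,
  crossing⇒bipartite splitR splitB crossesR crossesB
  where
  Ordered : List (Fin (suc d) × Fin (suc d)) → Set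
  Ordered = All (λ p → proj₁ p < proj₂ p)

  split : ∀ E → Ordered E → length E ≡ d ∸ 1 → HasRank (vecs E) (d ∸ 1) → SplitsInTwo (Adj E)
  split E <E |E| rankE =
    forest⇒split E (All.map <⇒≢ <E) (hasRank⇒indep rankE (trans (length-map vec E) |E|))
      (subst (λ k → suc d ≤ 2 + k) (sym |E|) (s≤s (m≤n+m∸n d 1)))

  splitR : SplitsInTwo (Adj R)
  splitR = split R <R |R| rankR

  splitB : SplitsInTwo (Adj B)
  splitB = split B <B |B| rankB

  crossesR : Crosses R B
  crossesR = independent⇒crosses R B (All.map <⇒≢ <R) (conjugate⇒indep d R B |R| |B| conjR)

  crossesB : Crosses B R
  crossesB = independent⇒crosses B R (All.map <⇒≢ <B) (conjugate⇒indep d B R |B| |R| conjB)
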